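{- For every integer $k\geq1$, every graph $G$ that is a subdivision of the $(k2^{k+1}\times k)$-wall $W_{k2^{k+1}\times k}$ contains a bipartite subgraph $\hat G\subseteq G$ which is a subdivision of the $(2k\times k)$-wall $W_{2k\times k}$.
   Context: All graphs are finite and simple. Walls: for integers $j,k\geq1$ and each $i\in[k]$, let $\bar P^{(i)}=(v^{(i)}_1,\dots,v^{(i)}_{2j})$ be a path on $2j$ vertices. The $(2j\times k)$-wall $W_{2j\times k}$ consists of the vertex-disjoint paths $\bar P^{(1)},\dots,\bar P^{(k)}$ together with, for each $\ell\in[j]$ and each $i\in\{2,\dots,k\}$, the edge $v^{(i-1)}_{2\ell}v^{(i)}_{2\ell}$ if $i$ is even and the edge $v^{(i-1)}_{2\ell-1}v^{(i)}_{2\ell-1}$ if $i$ is odd. (So $W_{k2^{k+1}\times k}$ is this graph with $j=k2^k$.) -}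

module Defs where

open import Data.Nat using (ℕ; zero; suc; _*_; _^_; _%_; _≤_)
open import Data.Fin using (Fin; toℕ)
open import Data.Bool using (Bool)
open import Data.List using (List; []; _∷_; reverse)
open import Data.List.Membership.Propositional using (_∈_)
open import Data.List.Relation.Unary.Unique.Propositional using (Unique)
open import Data.Product using (Σ; ∃; ∃-syntax; _×_; _,_)
open import Data.Sum using (_⊎_; inj₁; inj₂)
open import Relation.Nullary using (¬_)
open import Relation.Binary.PropositionalEquality using (_≡_; _≢_; refl)
open import Function.Definitions using (Injective)

record Graph (V : Set) : Set₁ where
  field
    Adj    : V → V → Set
    adj-sym : ∀ {u v} → Adj u v → Adj v u
    irrefl : ∀ {u} → ¬ Adj u u
open Graph public

data Walk {V : Set} (G : Graph V) : V → V → List V → Set where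
  [_]  : ∀ x → Walk G x x (x ∷ [])
  _∷_  : ∀ {x y z xs} → Adj G x y → Walk G y z xs → Walk G x z (x ∷ xs)

IsPath : {V : Set} → Graph V → V → V → List V → Set
IsPath G x y xs = Walk G x y xs × Unique xs

data Consec {A : Set} (x y : A) : List A → Set where
  here  : ∀ {xs} → Consec x y (x ∷ y ∷ xs)
  there : ∀ {z xs} → Consec x y xs → Consec x y (z ∷ xs)

record SubdivisionOf {W V : Set} (G : Graph W) (H : Graph V) : Set₁ where
  field
    φ       : V → W
    φ-inj   : Injective _≡_ _≡_ φ
    P       : (u v : V) → Adj H u v → List W
    P-path  : ∀ u v e → IsPath G (φ u) (φ v) (P u v e)
    P-rev   : ∀ u v e e' → P v u e' ≡ reverse (P u v e)
    P-branch : ∀ u v e w → φ w ∈ P u v e → (w ≡ u) ⊎ (w ≡ v)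
    P-disj  : ∀ u v e u' v' e' x → x ∈ P u v e → x ∈ P u' v' e' →
              (∀ w → x ≢ φ w) →
              (u ≡ u' × v ≡ v') ⊎ (u ≡ v' × v ≡ u')
    cover-V : ∀ x → (∃[ w ] x ≡ φ w) ⊎ (∃[ u ] ∃[ v ] Σ (Adj H u v) λ e → x ∈ P u v e)
    cover-E : ∀ x y → Adj G x y →
              ∃[ u ] ∃[ v ] Σ (Adj H u v) λ e → Consec x y (P u v e) ⊎ Consec y x (P u v e)

record SubgraphOf {V W : Set} (Ĝ : Graph V) (G : Graph W) : Set where
  field
    ι     : V → W
    ι-inj : Injective _≡_ _≡_ ι
    ι-adj : ∀ {a b} → Adj Ĝ a b → Adj G (ι a) (ι b)

Bipartite : {V : Set} → Graph V → Set
Bipartite {V} G = Σ (V → Bool) λ c → ∀ {a b} → Adj G a b → c a ≢ c b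

-- The (2j × k)-wall, 0-based: vertex (i , a) is v^{(i+1)}_{a+1}.
-- Rows are paths; a vertical edge joins (i , a) and (i' , a) with
-- toℕ i' = toℕ i + 1, present iff a ≡ i' (mod 2)
-- (1-based: row i'+1 even ⇔ position a+1 even).
WallV : ℕ → ℕ → Set
WallV j k = Fin k × Fin (2 * j)

data WallR (j k : ℕ) : WallV j k → WallV j k → Set where
  horiz : ∀ {i a b} → toℕ b ≡ suc (toℕ a) → WallR j k (i , a) (i , b)
  vert  : ∀ {i i' a} → toℕ i' ≡ suc (toℕ i) → toℕ a % 2 ≡ toℕ i' % 2 →
          WallR j k (i , a) (i' , a)

n≢1+n : ∀ n → n ≢ suc n
n≢1+n n ()

WallR-irrefl : ∀ {j k} {u : WallV j k} → ¬ WallR j k u u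
WallR-irrefl (horiz p) = n≢1+n _ p
WallR-irrefl (vert p _) = n≢1+n _ p

swap⊎ : {A B : Set} → A ⊎ B → B ⊎ A
swap⊎ (inj₁ a) = inj₂ a
swap⊎ (inj₂ b) = inj₁ b

Wall : (j k : ℕ) → Graph (WallV j k)
Wall j k = record
  { Adj = λ u v → WallR j k u v ⊎ WallR j k v u
  ; adj-sym = swap⊎
  ; irrefl = λ { (inj₁ r) → WallR-irrefl r ; (inj₂ r) → WallR-irrefl r } }

module Submission where

-- Give every edge of the large wall the parity of its subdivided path, and call the
-- parity of the walk along row i to a rung, across it, and back along row i + 1 the
-- potential of that rung. Rungs between rows i and i + 1 sit at j = k·2^k positions,
-- and a position carries a vector of k potentials, so k positions b 0 < ⋯ < b (k - 1)
-- share the same vector. The rows together with the rungs at these positions form a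
-- subdivision of W_{2k×k}; along each row its path parities are differences of row
-- parities, and across a rung they differ by the common potential, so they are those of
-- a 2-colouring of W_{2k×k}. Colouring each subdivided path alternately is then
-- consistent, and the union of the paths is the required bipartite subgraph.

open import Defs
open import Data.Nat using (ℕ; zero; suc; _+_; _*_; _^_; _∸_; _%_; _≤_; _<_; z≤n; s≤s; _≤?_; _<?_; ⌊_/2⌋; ⌈_/2⌉)
  renaming (_≟_ to _≟ℕ_)
open import Data.Nat.Properties
open import Data.Nat.DivMod using (m%n<n; m%n%n≡m%n; [m+kn]%n≡m%n)
open import Data.Fin using (Fin; toℕ; fromℕ<) renaming (_≟_ to _≟ᶠ_)
open import Data.Fin.Properties using (toℕ-injective; toℕ-fromℕ<; toℕ<n)
import Data.List.Membership.DecPropositional as DecMembership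
open import Data.Bool using (Bool; true; false; not; _xor_) renaming (_≟_ to _≟ᵇ_)
open import Data.Bool.Properties using (not-involutive; not-¬; xor-same; xor-comm; xor-assoc; not-distribˡ-xor; not-distribʳ-xor)
open import Data.Vec using (Vec; []; _∷_; head; tail; tabulate) renaming (lookup to lookupᵛ)
open import Data.Vec.Properties using (lookup∘tabulate)
open import Data.List using (List; []; _∷_; _++_; reverse; length; map; concatMap; filter; lookup; allFin; cartesianProduct; upTo)
open import Data.List.Properties using (length-upTo; ∷-injectiveˡ; unfold-reverse; reverse-involutive; map-injective; reverse-map)
open import Data.List.Membership.Propositional using (_∈_; _∉_; mapWith∈)
open import Data.List.Membership.Propositional.Properties
open import Data.List.Relation.Unary.Any as Any using (here; there)
open import Data.List.Relation.Unary.Any.Properties using (lookup-index; reverse⁺; reverse⁻)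
open import Data.List.Relation.Unary.All as All using (All; []; _∷_)
import Data.List.Relation.Unary.All.Properties as All
open import Data.List.Relation.Unary.AllPairs using ([]; _∷_)
open import Data.List.Relation.Unary.Linked using (Linked; [-]; _∷_)
import Data.List.Relation.Unary.Linked.Properties as Linked
open import Data.List.Relation.Unary.Unique.Propositional using (Unique)
import Data.List.Relation.Unary.Unique.Propositional.Properties as Unique
open import Data.Product using (Σ; ∃-syntax; _×_; _,_; proj₁; proj₂)
open import Data.Product.Properties using (≡-dec)
open import Data.Sum using (_⊎_; inj₁; inj₂; [_,_]′)
open import Data.Empty using (⊥; ⊥-elim)
open import Relation.Nullary using (¬_; Dec; yes; no; ¬¬-excluded-middle; decidable-stable; _×-dec_; _⊎-dec_)
open import Relation.Binary.Definitions using (DecidableEquality; tri<; tri≈; tri>)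
open import Relation.Binary.PropositionalEquality using (_≡_; _≢_; refl; sym; trans; cong; cong₂; subst; subst₂; module ≡-Reasoning)
open import Function.Definitions using (Injective)
open import Function using (_∘′_; id)
open import Data.Bool.Solver using (module xor-∧-Solver)

-- Lists

module _ {A : Set} where

  Unique-++⁻ : (xs : List A) {ys : List A} → Unique (xs ++ ys) →
               Unique xs × Unique ys × (∀ {z} → z ∈ xs → z ∉ ys)
  Unique-++⁻ [] u = [] , u , λ ()
  Unique-++⁻ (x ∷ xs) {ys} (x∉ ∷ u) with Unique-++⁻ xs u
  ... | uxs , uys , disjoint = All.++⁻ˡ xs x∉ ∷ uxs , uys , disjoint′
    where
    disjoint′ : ∀ {z} → z ∈ x ∷ xs → z ∉ ys
    disjoint′ (here refl) z∈ys = All.lookup (All.++⁻ʳ xs x∉) z∈ys refl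
    disjoint′ (there z∈xs) = disjoint z∈xs

  Unique-reverse : {xs : List A} → Unique xs → Unique (reverse xs)
  Unique-reverse {[]} u = u
  Unique-reverse {x ∷ xs} u@(_ ∷ uxs) = subst Unique (sym (unfold-reverse x xs))
    (Unique.++⁺ (Unique-reverse uxs) ([] ∷ [])
      λ { (x∈ , here refl) → Unique.Unique[x∷xs]⇒x∉xs u (reverse⁻ x∈) })

  lookup-injective : {xs : List A} → Unique xs → Injective _≡_ _≡_ (lookup xs)
  lookup-injective {x ∷ xs} u {Fin.zero} {Fin.zero} eq = refl
  lookup-injective {x ∷ xs} u {Fin.zero} {Fin.suc j} eq =
    ⊥-elim (Unique.Unique[x∷xs]⇒x∉xs u (subst (_∈ xs) (sym eq) (∈-lookup j)))
  lookup-injective {x ∷ xs} u {Fin.suc i} {Fin.zero} eq =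
    ⊥-elim (Unique.Unique[x∷xs]⇒x∉xs u (subst (_∈ xs) eq (∈-lookup i)))
  lookup-injective {x ∷ xs} (_ ∷ u) {Fin.suc i} {Fin.suc j} eq = cong Fin.suc (lookup-injective u eq)

  ≡-either-∈ : {x a b : A} {xs : List A} → (x ≡ a) ⊎ (x ≡ b) → a ∈ xs → b ∈ xs → x ∈ xs
  ≡-either-∈ (inj₁ refl) a∈ _ = a∈
  ≡-either-∈ (inj₂ refl) _ b∈ = b∈

  Consec-≢ : {x y : A} {xs : List A} → Unique xs → Consec x y xs → x ≢ y
  Consec-≢ (x∉ ∷ _) here refl = All.lookup x∉ (here refl) refl
  Consec-≢ (_ ∷ u) (there c) = Consec-≢ u c

Consec-map⁺ : {A B : Set} (f : A → B) {a b : A} {xs : List A} → Consec a b xs → Consec (f a) (f b) (map f xs)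
Consec-map⁺ f here = here
Consec-map⁺ f (there c) = there (Consec-map⁺ f c)

oddLength : {A : Set} → List A → Bool
oddLength [] = false
oddLength (_ ∷ xs) = not (oddLength xs)

oddLength-++ : {A : Set} (xs ys : List A) → oddLength (xs ++ ys) ≡ oddLength xs xor oddLength ys
oddLength-++ [] ys = refl
oddLength-++ (x ∷ xs) ys = trans (cong not (oddLength-++ xs ys)) (not-distribˡ-xor (oddLength xs) (oddLength ys))

oddLength-reverse : {A : Set} (xs : List A) → oddLength (reverse xs) ≡ oddLength xs
oddLength-reverse [] = refl
oddLength-reverse (x ∷ xs) = begin
  oddLength (reverse (x ∷ xs))              ≡⟨ cong oddLength (unfold-reverse x xs) ⟩
  oddLength (reverse xs ++ x ∷ [])          ≡⟨ oddLength-++ (reverse xs) (x ∷ []) ⟩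
  oddLength (reverse xs) xor true           ≡⟨ cong (_xor true) (oddLength-reverse xs) ⟩
  oddLength xs xor true                     ≡⟨ xor-comm (oddLength xs) true ⟩
  not (oddLength xs)                        ∎
  where open ≡-Reasoning

module _ {A : Set} where

  alternating : List A → Bool → List (A × Bool)
  alternating [] β = []
  alternating (x ∷ xs) β = (x , β) ∷ alternating xs (not β)

  alternating-∈ : ∀ {xs x} β → x ∈ xs → Σ Bool λ γ → (x , γ) ∈ alternating xs β
  alternating-∈ β (here refl) = β , here refl
  alternating-∈ β (there x∈) with alternating-∈ (not β) x∈
  ... | γ , x,γ∈ = γ , there x,γ∈

  alternating-∈⁻ : ∀ {xs β x γ} → (x , γ) ∈ alternating xs β → x ∈ xs
  alternating-∈⁻ {_ ∷ _} (here refl) = here refl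
  alternating-∈⁻ {_ ∷ _} (there x,γ∈) = there (alternating-∈⁻ x,γ∈)

  alternating-functional : ∀ {xs β x γ γ′} → Unique xs →
    (x , γ) ∈ alternating xs β → (x , γ′) ∈ alternating xs β → γ ≡ γ′
  alternating-functional {_ ∷ _} u (here refl) (here refl) = refl
  alternating-functional {_ ∷ _} u (here refl) (there m′) =
    ⊥-elim (Unique.Unique[x∷xs]⇒x∉xs u (alternating-∈⁻ m′))
  alternating-functional {_ ∷ _} u (there m) (here refl) =
    ⊥-elim (Unique.Unique[x∷xs]⇒x∉xs u (alternating-∈⁻ m))
  alternating-functional {_ ∷ _} (_ ∷ u) (there m) (there m′) = alternating-functional u m m′

  alternating-Consec : ∀ {xs β x y} → Consec x y xs →
    Σ Bool λ γ → (x , γ) ∈ alternating xs β × (y , not γ) ∈ alternating xs β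
  alternating-Consec {β = β} here = β , here refl , there (here refl)
  alternating-Consec {_ ∷ _} {β} (there c) with alternating-Consec {β = not β} c
  ... | γ , x∈ , y∈ = γ , there x∈ , there y∈

  alternating-∷ʳ : ∀ xs y β → alternating (xs ++ y ∷ []) β ≡ alternating xs β ++ (y , β xor oddLength xs) ∷ []
  alternating-∷ʳ [] y β = cong (λ γ → (y , γ) ∷ []) (sym (xor-comm β false))
  alternating-∷ʳ (x ∷ xs) y β = cong ((x , β) ∷_) (trans (alternating-∷ʳ xs y (not β))
    (cong (λ γ → alternating xs (not β) ++ (y , γ) ∷ []) last-colour))
    where
    last-colour : not β xor oddLength xs ≡ β xor not (oddLength xs)
    last-colour = trans (sym (not-distribˡ-xor β (oddLength xs))) (not-distribʳ-xor β (oddLength xs))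

  alternating-reverse : ∀ xs β → alternating (reverse xs) (β xor not (oddLength xs)) ≡ reverse (alternating xs β)
  alternating-reverse [] β = refl
  alternating-reverse (x ∷ xs) β = begin
    alternating (reverse (x ∷ xs)) (β xor not (not o))
      ≡⟨ cong₂ alternating (unfold-reverse x xs) (cong (β xor_) (not-involutive o)) ⟩
    alternating (reverse xs ++ x ∷ []) (β xor o)
      ≡⟨ alternating-∷ʳ (reverse xs) x (β xor o) ⟩
    alternating (reverse xs) (β xor o) ++ (x , (β xor o) xor oddLength (reverse xs)) ∷ []
      ≡⟨ cong₂ (λ γ δ → alternating (reverse xs) γ ++ (x , δ) ∷ []) first-colour last-colour ⟩
    alternating (reverse xs) (not β xor not o) ++ (x , β) ∷ []
      ≡⟨ cong (_++ (x , β) ∷ []) (alternating-reverse xs (not β)) ⟩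
    reverse (alternating xs (not β)) ++ (x , β) ∷ []
      ≡⟨ unfold-reverse (x , β) (alternating xs (not β)) ⟨
    reverse (alternating (x ∷ xs) β) ∎
    where
    open ≡-Reasoning
    o = oddLength xs
    first-colour : β xor o ≡ not β xor not o
    first-colour = sym (trans (sym (not-distribˡ-xor β (not o)))
      (trans (cong not (sym (not-distribʳ-xor β o))) (not-involutive (β xor o))))
    last-colour : (β xor o) xor oddLength (reverse xs) ≡ β
    last-colour = begin
      (β xor o) xor oddLength (reverse xs) ≡⟨ cong ((β xor o) xor_) (oddLength-reverse xs) ⟩
      (β xor o) xor o                      ≡⟨ xor-assoc β o o ⟩
      β xor (o xor o)                      ≡⟨ cong (β xor_) (xor-same o) ⟩
      β xor false                          ≡⟨ xor-comm β false ⟩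
      β                                    ∎

-- Walks and subdivisions

SamePair : {A : Set} → A → A → A → A → Set
SamePair u v u′ v′ = (u ≡ u′ × v ≡ v′) ⊎ (u ≡ v′ × v ≡ u′)

module _ {A : Set} where

  SamePair-fst : {u v u′ v′ : A} → SamePair u v u′ v′ → (u ≡ u′) ⊎ (u ≡ v′)
  SamePair-fst (inj₁ (p , _)) = inj₁ p
  SamePair-fst (inj₂ (p , _)) = inj₂ p

  SamePair-snd : {u v u′ v′ : A} → SamePair u v u′ v′ → (v ≡ v′) ⊎ (v ≡ u′)
  SamePair-snd (inj₁ (_ , q)) = inj₁ q
  SamePair-snd (inj₂ (_ , q)) = inj₂ q

  SamePair-swapˡ : {u v u′ v′ : A} → SamePair u v u′ v′ → SamePair v u u′ v′
  SamePair-swapˡ (inj₁ (p , q)) = inj₂ (q , p)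
  SamePair-swapˡ (inj₂ (p , q)) = inj₁ (q , p)

  SamePair-swapʳ : {u v u′ v′ : A} → SamePair u v u′ v′ → SamePair u v v′ u′
  SamePair-swapʳ (inj₁ (p , q)) = inj₂ (p , q)
  SamePair-swapʳ (inj₂ (p , q)) = inj₁ (p , q)

  samePair? : DecidableEquality A → (u v u′ v′ : A) → Dec (SamePair u v u′ v′)
  samePair? _≟_ u v u′ v′ = (u ≟ u′ ×-dec v ≟ v′) ⊎-dec (u ≟ v′ ×-dec v ≟ u′)

  two-common-ends⇒SamePair : {w₁ w₂ u v u′ v′ : A} → w₁ ≢ w₂ →
    (w₁ ≡ u) ⊎ (w₁ ≡ v) → (w₂ ≡ u) ⊎ (w₂ ≡ v) → (w₁ ≡ u′) ⊎ (w₁ ≡ v′) → (w₂ ≡ u′) ⊎ (w₂ ≡ v′) →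
    SamePair u v u′ v′
  two-common-ends⇒SamePair w₁≢w₂ (inj₁ refl) (inj₁ refl) _ _ = ⊥-elim (w₁≢w₂ refl)
  two-common-ends⇒SamePair w₁≢w₂ (inj₂ refl) (inj₂ refl) _ _ = ⊥-elim (w₁≢w₂ refl)
  two-common-ends⇒SamePair w₁≢w₂ _ _ (inj₁ refl) (inj₁ refl) = ⊥-elim (w₁≢w₂ refl)
  two-common-ends⇒SamePair w₁≢w₂ _ _ (inj₂ refl) (inj₂ refl) = ⊥-elim (w₁≢w₂ refl)
  two-common-ends⇒SamePair _ (inj₁ refl) (inj₂ refl) (inj₁ refl) (inj₂ refl) = inj₁ (refl , refl)
  two-common-ends⇒SamePair _ (inj₁ refl) (inj₂ refl) (inj₂ refl) (inj₁ refl) = inj₂ (refl , refl)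
  two-common-ends⇒SamePair _ (inj₂ refl) (inj₁ refl) (inj₁ refl) (inj₂ refl) = inj₂ (refl , refl)
  two-common-ends⇒SamePair _ (inj₂ refl) (inj₁ refl) (inj₂ refl) (inj₁ refl) = inj₁ (refl , refl)

module _ {W : Set} {G : Graph W} where

  Walk-head : ∀ {x y xs} → Walk G x y xs → Σ (List W) λ t → xs ≡ x ∷ t
  Walk-head [ x ] = [] , refl
  Walk-head (_∷_ {xs = xs} _ _) = xs , refl

  Walk-start-∈ : ∀ {x y xs} → Walk G x y xs → x ∈ xs
  Walk-start-∈ [ x ] = here refl
  Walk-start-∈ (_ ∷ _) = here refl

  Walk-∷ʳ : ∀ {x y z xs} → Walk G x y xs → Adj G y z → Walk G x z (xs ++ z ∷ [])
  Walk-∷ʳ [ x ] e = e ∷ [ _ ]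
  Walk-∷ʳ (e′ ∷ w) e = e′ ∷ Walk-∷ʳ w e

  Walk-reverse : ∀ {x y xs} → Walk G x y xs → Walk G y x (reverse xs)
  Walk-reverse [ x ] = [ x ]
  Walk-reverse (_∷_ {x} {_} {z} {xs} e w) =
    subst (Walk G z x) (sym (unfold-reverse x xs)) (Walk-∷ʳ (Walk-reverse w) (adj-sym G e))

  Walk-Consec⇒Adj : ∀ {x y xs a b} → Walk G x y xs → Consec a b xs → Adj G a b
  Walk-Consec⇒Adj (e ∷ [ _ ]) here = e
  Walk-Consec⇒Adj (e ∷ (_ ∷ _)) here = e
  Walk-Consec⇒Adj (_ ∷ w) (there c) = Walk-Consec⇒Adj w c

  init++ : ∀ {a b xs} → Walk G a b xs → List W → List W
  init++ [ a ] l = l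
  init++ (_∷_ {a} _ w) l = a ∷ init++ w l

  Walk-init++ : ∀ {a b c xs ys} (w : Walk G a b xs) → Walk G b c ys → Walk G a c (init++ w ys)
  Walk-init++ [ a ] w′ = w′
  Walk-init++ (e ∷ w) w′ = e ∷ Walk-init++ w w′

  init++-split : ∀ {a b xs} (w : Walk G a b xs) (l : List W) →
    Σ (List W) λ ys → xs ≡ ys ++ b ∷ [] × init++ w l ≡ ys ++ l
  init++-split [ a ] l = [] , refl , refl
  init++-split (_∷_ {a} _ w) l with init++-split w l
  ... | ys , p , q = a ∷ ys , cong (a ∷_) p , cong (a ∷_) q

Walk-map⁻ : {A B : Set} {Ĝ : Graph A} {G : Graph B} {f : A → B} → Injective _≡_ _≡_ f →
  ∀ (l : List A) {x y} → Walk G x y (map f l) → (∀ {a b} → Consec a b l → Adj Ĝ a b) →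
  ∀ {a₀ b₀} → f a₀ ≡ x → f b₀ ≡ y → Walk Ĝ a₀ b₀ l
Walk-map⁻ f-inj (a ∷ []) [ _ ] adj fa₀≡ fb₀≡ with f-inj fa₀≡ | f-inj fb₀≡
... | refl | refl = [ a ]
Walk-map⁻ f-inj (a ∷ b ∷ l) (_ ∷ w) adj fa₀≡ fb₀≡ with f-inj fa₀≡ | Walk-head w
... | refl | _ , fb∷≡ = adj here ∷ Walk-map⁻ f-inj (b ∷ l) w (adj ∘′ there) (∷-injectiveˡ fb∷≡) fb₀≡

-- A subdivision of H inside G: SubdivisionOf without the covering conditions.
record TopMinor {W V : Set} (G : Graph W) (H : Graph V) : Set₁ where
  field
    φ        : V → W
    φ-inj    : Injective _≡_ _≡_ φ
    P        : (u v : V) → Adj H u v → List W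
    P-path   : ∀ u v e → IsPath G (φ u) (φ v) (P u v e)
    P-rev    : ∀ u v e e′ → P v u e′ ≡ reverse (P u v e)
    P-branch : ∀ u v e w → φ w ∈ P u v e → (w ≡ u) ⊎ (w ≡ v)
    P-disj   : ∀ u v e u′ v′ e′ x → x ∈ P u v e → x ∈ P u′ v′ e′ → (∀ w → x ≢ φ w) → SamePair u v u′ v′

  P-walk : ∀ {u v} (e : Adj H u v) → Walk G (φ u) (φ v) (P u v e)
  P-walk {u} {v} e = proj₁ (P-path u v e)

  P-unique : ∀ {u v} (e : Adj H u v) → Unique (P u v e)
  P-unique {u} {v} e = proj₂ (P-path u v e)

  P-irrelevant : ∀ {u v} (e e′ : Adj H u v) → P u v e ≡ P u v e′
  P-irrelevant {u} {v} e e′ = trans (P-rev v u (adj-sym H e) e) (sym (P-rev v u (adj-sym H e) e′))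

  -- oddLength counts vertices: the path has an odd number of edges iff this is true.
  pathParity : ∀ {u v} → Adj H u v → Bool
  pathParity {u} {v} e = not (oddLength (P u v e))

  walkParity : ∀ {x y xs} → Walk H x y xs → Bool
  walkParity [ x ] = false
  walkParity (e ∷ w) = pathParity e xor walkParity w

  interior⇒¬branch : ∀ {u v} (e : Adj H u v) {x} → x ∈ P u v e → x ≢ φ u → x ≢ φ v → ∀ w → x ≢ φ w
  interior⇒¬branch {u} {v} e {x} x∈ x≢u x≢v w x≡w with P-branch u v e w (subst (_∈ P u v e) x≡w x∈)
  ... | inj₁ refl = x≢u x≡w
  ... | inj₂ refl = x≢v x≡w

SubdivisionOf⇒TopMinor : {W V : Set} {G : Graph W} {H : Graph V} → SubdivisionOf G H → TopMinor G H
SubdivisionOf⇒TopMinor S = record { SubdivisionOf S }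

-- Composing subdivisions

-- A TopMinor H₁ H₂ given only along an orientation R of the edges of H₂, with walks
-- for paths; Compose obtains the reverse direction by reversal.
record OrientedTopMinor {V₁ V₂ : Set} (H₁ : Graph V₁) (R : V₂ → V₂ → Set) : Set where
  field
    ψ        : V₂ → V₁
    ψ-inj    : Injective _≡_ _≡_ ψ
    Q        : ∀ {u v} → R u v → List V₁
    Q-walk   : ∀ {u v} (r : R u v) → Walk H₁ (ψ u) (ψ v) (Q r)
    Q-unique : ∀ {u v} (r : R u v) → Unique (Q r)
    Q-branch : ∀ {u v} (r : R u v) w → ψ w ∈ Q r → (w ≡ u) ⊎ (w ≡ v)
    Q-disj   : ∀ {u v u′ v′} (r : R u v) (r′ : R u′ v′) x → x ∈ Q r → x ∈ Q r′ →
               (∀ w → x ≢ ψ w) → SamePair u v u′ v′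

module Compose {W V₁ V₂ : Set} {G : Graph W} {H₁ : Graph V₁} {R : V₂ → V₂ → Set}
  (S : TopMinor G H₁) (T : OrientedTopMinor H₁ R) where

  open TopMinor S
  open OrientedTopMinor T

  expand : ∀ {x y xs} → Walk H₁ x y xs → List W
  expand [ x ] = φ x ∷ []
  expand (e ∷ w) = init++ (P-walk e) (expand w)

  expand-walk : ∀ {x y xs} (w : Walk H₁ x y xs) → Walk G (φ x) (φ y) (expand w)
  expand-walk [ x ] = [ φ x ]
  expand-walk (e ∷ w) = Walk-init++ (P-walk e) (expand-walk w)

  oddLength-expand : ∀ {x y xs} (w : Walk H₁ x y xs) → oddLength (expand w) ≡ not (walkParity w)
  oddLength-expand [ x ] = refl
  oddLength-expand (_∷_ {x} {y} e w) with init++-split (P-walk e) (expand w)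
  ... | ys , P≡ , expand≡ = begin
    oddLength (expand (e ∷ w))              ≡⟨ cong oddLength expand≡ ⟩
    oddLength (ys ++ expand w)              ≡⟨ oddLength-++ ys (expand w) ⟩
    oddLength ys xor oddLength (expand w)   ≡⟨ cong₂ _xor_ ys-parity (oddLength-expand w) ⟩
    pathParity e xor not (walkParity w)     ≡⟨ not-distribʳ-xor (pathParity e) (walkParity w) ⟨
    not (walkParity (e ∷ w))                ∎
    where
    open ≡-Reasoning
    ys-parity : oddLength ys ≡ pathParity e
    ys-parity = begin
      oddLength ys                          ≡⟨ not-involutive (oddLength ys) ⟨
      not (not (oddLength ys))              ≡⟨ cong not (xor-comm (oddLength ys) true) ⟨
      not (oddLength ys xor true)           ≡⟨ cong not (oddLength-++ ys (φ y ∷ [])) ⟨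
      not (oddLength (ys ++ φ y ∷ []))      ≡⟨ cong (not ∘′ oddLength) P≡ ⟨
      pathParity e                          ∎

  data OnExpansion (xs : List V₁) (z : W) : Set where
    branch : ∀ {a} → a ∈ xs → z ≡ φ a → OnExpansion xs z
    inner  : ∀ {a b} (e : Adj H₁ a b) → a ∈ xs → b ∈ xs → z ∈ P a b e → OnExpansion xs z

  expand-∈ : ∀ {x y xs} (w : Walk H₁ x y xs) {z} → z ∈ expand w → OnExpansion xs z
  expand-∈ [ x ] (here refl) = branch (here refl) refl
  expand-∈ (_∷_ {x} {y} e w) {z} z∈ with init++-split (P-walk e) (expand w)
  ... | ys , P≡ , expand≡ with ∈-++⁻ ys (subst (z ∈_) expand≡ z∈)
  ... | inj₁ z∈ys = inner e (here refl) (there (Walk-start-∈ w)) (subst (z ∈_) (sym P≡) (∈-++⁺ˡ z∈ys))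
  ... | inj₂ z∈′ with expand-∈ w z∈′
  ...   | branch a∈ z≡ = branch (there a∈) z≡
  ...   | inner e′ a∈ b∈ z∈P = inner e′ (there a∈) (there b∈) z∈P

  φ-∈-expand : ∀ {x y xs} (w : Walk H₁ x y xs) {a} → φ a ∈ expand w → a ∈ xs
  φ-∈-expand w {a} φa∈ with expand-∈ w φa∈
  ... | branch a′∈ φa≡ = subst (_∈ _) (sym (φ-inj φa≡)) a′∈
  ... | inner {a′} {b′} e a′∈ b′∈ φa∈P = ≡-either-∈ (P-branch a′ b′ e a φa∈P) a′∈ b′∈

  expand-unique : ∀ {x y xs} (w : Walk H₁ x y xs) → Unique xs → Unique (expand w)
  expand-unique [ x ] _ = [] ∷ []
  expand-unique (_∷_ {x} {y} {_} {xs} e w) u@(_ ∷ uxs) with init++-split (P-walk e) (expand w)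
  ... | ys , P≡ , expand≡ = subst Unique (sym expand≡)
        (Unique.++⁺ (proj₁ ys-parts) (expand-unique w uxs) λ (t∈ys , t∈) → disjoint t∈ys (expand-∈ w t∈))
    where
    x∉xs : x ∉ xs
    x∉xs = Unique.Unique[x∷xs]⇒x∉xs u
    ys-parts = Unique-++⁻ ys (subst Unique P≡ (P-unique e))
    on-P : ∀ {t} → t ∈ ys → t ∈ P x y e
    on-P t∈ = subst (_ ∈_) (sym P≡) (∈-++⁺ˡ t∈)
    ≢φy : ∀ {t} → t ∈ ys → t ≢ φ y
    ≢φy t∈ refl = proj₂ (proj₂ ys-parts) t∈ (here refl)
    disjoint : ∀ {t} → t ∈ ys → OnExpansion xs t → ⊥
    disjoint t∈ (branch {a} a∈ refl) with P-branch x y e a (on-P t∈)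
    ... | inj₁ refl = x∉xs a∈
    ... | inj₂ refl = ≢φy t∈ refl
    disjoint {t} t∈ (inner {a} {b} e′ a∈ b∈ t∈P′) = ¬¬-excluded-middle {A = t ≡ φ x} λ where
      (yes refl) → x∉xs (≡-either-∈ (P-branch a b e′ x t∈P′) a∈ b∈)
      (no t≢φx) → x∉xs (≡-either-∈ (SamePair-fst (P-disj x y e a b e′ t (on-P t∈) t∈P′
                          (interior⇒¬branch e (on-P t∈) t≢φx (≢φy t∈)))) a∈ b∈)

  path : ∀ {u v} → R u v → List W
  path r = expand (Q-walk r)

  path-parity : ∀ {u v} (r : R u v) → not (oddLength (path r)) ≡ walkParity (Q-walk r)
  path-parity r = trans (cong not (oddLength-expand (Q-walk r))) (not-involutive _)

  path-disj : DecidableEquality V₂ → ∀ {u v u′ v′} (r : R u v) (r′ : R u′ v′) x → x ∈ path r → x ∈ path r′ →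
              (∀ w → x ≢ φ (ψ w)) → SamePair u v u′ v′
  path-disj _≟_ {u} {v} {u′} {v′} r r′ x x∈ x∈′ ¬branch =
    decidable-stable (samePair? _≟_ u v u′ v′) λ ¬same →
    ¬¬-excluded-middle {A = Σ V₁ λ z → x ≡ φ z} λ where
      (yes (z , refl)) → ¬same (Q-disj r r′ z (φ-∈-expand (Q-walk r) x∈) (φ-∈-expand (Q-walk r′) x∈′)
                                  λ w z≡ψw → ¬branch w (cong φ z≡ψw))
      (no ¬φ) → inner-case ¬same ¬φ (expand-∈ (Q-walk r) x∈) (expand-∈ (Q-walk r′) x∈′)
    where
    shared-edge : ¬ SamePair u v u′ v′ → ∀ {a b} → a ≢ b → a ∈ Q r → b ∈ Q r → a ∈ Q r′ → b ∈ Q r′ → ⊥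
    shared-edge ¬same {a} {b} a≢b a∈ b∈ a∈′ b∈′ =
      ¬¬-excluded-middle {A = Σ V₂ λ w → a ≡ ψ w} λ where
        (no a∉ψ) → ¬same (Q-disj r r′ a a∈ a∈′ λ w a≡ → a∉ψ (w , a≡))
        (yes (w₁ , refl)) → ¬¬-excluded-middle {A = Σ V₂ λ w → b ≡ ψ w} λ where
          (no b∉ψ) → ¬same (Q-disj r r′ b b∈ b∈′ λ w b≡ → b∉ψ (w , b≡))
          (yes (w₂ , refl)) → ¬same (two-common-ends⇒SamePair (λ { refl → a≢b refl })
            (Q-branch r w₁ a∈) (Q-branch r w₂ b∈) (Q-branch r′ w₁ a∈′) (Q-branch r′ w₂ b∈′))
    inner-case : ¬ SamePair u v u′ v′ → ¬ (Σ V₁ λ z → x ≡ φ z) →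
                 OnExpansion (Q r) x → OnExpansion (Q r′) x → ⊥
    inner-case _ ¬φ (branch _ x≡) _ = ¬φ (_ , x≡)
    inner-case _ ¬φ (inner _ _ _ _) (branch _ x≡) = ¬φ (_ , x≡)
    inner-case ¬same ¬φ (inner {a} {b} e a∈ b∈ x∈P) (inner {a′} {b′} e′ a′∈ b′∈ x∈P′) =
      shared-edge ¬same (λ { refl → irrefl H₁ e }) a∈ b∈
        (≡-either-∈ (SamePair-fst same) a′∈ b′∈) (≡-either-∈ (SamePair-snd same) b′∈ a′∈)
      where
      same = P-disj a b e a′ b′ e′ x x∈P x∈P′ λ w x≡ → ¬φ (w , x≡)

  module _ (H₂ : Graph V₂) (_≟_ : DecidableEquality V₂)
    (toR : ∀ {u v} → Adj H₂ u v → R u v ⊎ R v u)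
    (R-asym : ∀ {u v} → R u v → R v u → ⊥) (R-irrelevant : ∀ {u v} (r r′ : R u v) → r ≡ r′) where

    composite-P : (u v : V₂) → Adj H₂ u v → List W
    composite-P u v e with toR e
    ... | inj₁ r = path r
    ... | inj₂ r = reverse (path r)

    private
      composite-P-∈ : ∀ {u v} (e : Adj H₂ u v) {x} → x ∈ composite-P u v e →
                      Σ (R u v) (λ r → x ∈ path r) ⊎ Σ (R v u) (λ r → x ∈ path r)
      composite-P-∈ e x∈ with toR e
      ... | inj₁ r = inj₁ (r , x∈)
      ... | inj₂ r = inj₂ (r , reverse⁻ x∈)

    composite : TopMinor G H₂
    composite = record
      { φ = φ ∘′ ψ
      ; φ-inj = ψ-inj ∘′ φ-inj
      ; P = composite-P
      ; P-path = P-path′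
      ; P-rev = P-rev′
      ; P-branch = P-branch′
      ; P-disj = P-disj′
      }
      where
      P-path′ : ∀ u v e → IsPath G (φ (ψ u)) (φ (ψ v)) (composite-P u v e)
      P-path′ u v e with toR e
      ... | inj₁ r = expand-walk (Q-walk r) , expand-unique (Q-walk r) (Q-unique r)
      ... | inj₂ r = Walk-reverse (expand-walk (Q-walk r)) , Unique-reverse (expand-unique (Q-walk r) (Q-unique r))
      P-rev′ : ∀ u v e e′ → composite-P v u e′ ≡ reverse (composite-P u v e)
      P-rev′ u v e e′ with toR e | toR e′
      ... | inj₁ r | inj₁ r′ = ⊥-elim (R-asym r r′)
      ... | inj₁ r | inj₂ r′ = cong (reverse ∘′ path) (R-irrelevant r′ r)
      ... | inj₂ r | inj₁ r′ = trans (cong path (R-irrelevant r′ r)) (sym (reverse-involutive (path r)))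
      ... | inj₂ r | inj₂ r′ = ⊥-elim (R-asym r r′)
      P-branch′ : ∀ u v e w → φ (ψ w) ∈ composite-P u v e → (w ≡ u) ⊎ (w ≡ v)
      P-branch′ u v e w φψw∈ with composite-P-∈ e φψw∈
      ... | inj₁ (r , ∈path) = Q-branch r w (φ-∈-expand (Q-walk r) ∈path)
      ... | inj₂ (r , ∈path) = swap⊎ (Q-branch r w (φ-∈-expand (Q-walk r) ∈path))
      P-disj′ : ∀ u v e u′ v′ e′ x → x ∈ composite-P u v e → x ∈ composite-P u′ v′ e′ →
                (∀ w → x ≢ φ (ψ w)) → SamePair u v u′ v′
      P-disj′ u v e u′ v′ e′ x x∈ x∈′ ¬branch with composite-P-∈ e x∈ | composite-P-∈ e′ x∈′
      ... | inj₁ (r , m) | inj₁ (r′ , m′) = path-disj _≟_ r r′ x m m′ ¬branch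
      ... | inj₁ (r , m) | inj₂ (r′ , m′) = SamePair-swapʳ (path-disj _≟_ r r′ x m m′ ¬branch)
      ... | inj₂ (r , m) | inj₁ (r′ , m′) = SamePair-swapˡ (path-disj _≟_ r r′ x m m′ ¬branch)
      ... | inj₂ (r , m) | inj₂ (r′ , m′) = SamePair-swapˡ (SamePair-swapʳ (path-disj _≟_ r r′ x m m′ ¬branch))

    composite-parity : (c : V₂ → Bool) → (∀ {u v} (r : R u v) → walkParity (Q-walk r) ≡ c u xor c v) →
                       ∀ u v e → TopMinor.pathParity composite e ≡ c u xor c v
    composite-parity c walk-parity u v e with toR e
    ... | inj₁ r = trans (path-parity r) (walk-parity r)
    ... | inj₂ r = trans (cong not (oddLength-reverse (path r)))
                     (trans (path-parity r) (trans (walk-parity r) (xor-comm (c v) (c u))))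

-- Bipartite subdivisions

-- Colouring every path alternately from c at its ends is consistent, since the
-- path parities are those of c.
module BipartiteSubdivision {n : ℕ} {V : Set} {G : Graph (Fin n)} {H : Graph V} (S : TopMinor G H)
  (vertices : List V) (∈-vertices : ∀ v → v ∈ vertices) (adj? : ∀ u v → Dec (Adj H u v))
  (c : V → Bool) (parity : ∀ u v e → TopMinor.pathParity S {u} {v} e ≡ c u xor c v) where

  open TopMinor S
  open DecMembership (_≟ᶠ_ {n}) using (_∈?_)

  colouredPath : ∀ {u v} → Adj H u v → List (Fin n × Bool)
  colouredPath {u} {v} e = alternating (P u v e) (c u)

  colouredPath-rev : ∀ {u v} (e : Adj H u v) (e′ : Adj H v u) → colouredPath e′ ≡ reverse (colouredPath e)
  colouredPath-rev {u} {v} e e′ = begin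
    alternating (P v u e′) (c v)                             ≡⟨ cong₂ alternating (P-rev u v e e′) (sym last-colour) ⟩
    alternating (reverse (P u v e)) (c u xor pathParity e)   ≡⟨ alternating-reverse (P u v e) (c u) ⟩
    reverse (alternating (P u v e) (c u))                    ∎
    where
    open ≡-Reasoning
    last-colour : c u xor pathParity e ≡ c v
    last-colour = begin
      c u xor pathParity e     ≡⟨ cong (c u xor_) (parity u v e) ⟩
      c u xor (c u xor c v)    ≡⟨ xor-assoc (c u) (c u) (c v) ⟨
      (c u xor c u) xor c v    ≡⟨ cong (_xor c v) (xor-same (c u)) ⟩
      c v                      ∎

  colouredPath-swap : ∀ {u v} (e : Adj H u v) (e′ : Adj H v u) {p} → p ∈ colouredPath e → p ∈ colouredPath e′
  colouredPath-swap e e′ p∈ = subst (_ ∈_) (sym (colouredPath-rev e e′)) (reverse⁺ p∈)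

  colouredPath-start : ∀ {u v} (e : Adj H u v) {β} → (φ u , β) ∈ colouredPath e → β ≡ c u
  colouredPath-start {u} e φu∈ with Walk-head (P-walk e)
  ... | _ , P≡ = alternating-functional (P-unique e) φu∈ (subst (λ l → (φ u , c u) ∈ alternating l (c u)) (sym P≡) (here refl))

  colouredPath-branch : ∀ {u v} (e : Adj H u v) w {β} → (φ w , β) ∈ colouredPath e → β ≡ c w
  colouredPath-branch {u} {v} e w φw∈ with P-branch u v e w (alternating-∈⁻ φw∈)
  ... | inj₁ refl = colouredPath-start e φw∈
  ... | inj₂ refl = colouredPath-start (adj-sym H e) (colouredPath-swap e (adj-sym H e) φw∈)

  data Coloured (x : Fin n) (β : Bool) : Set where
    at-branch : ∀ w → x ≡ φ w → β ≡ c w → Coloured x β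
    on-path   : ∀ {u v} (e : Adj H u v) → (x , β) ∈ colouredPath e → Coloured x β

  Coloured-functional : ∀ {x β β′} → Coloured x β → Coloured x β′ → β ≡ β′
  Coloured-functional (at-branch w refl refl) (at-branch w′ φw≡ refl) = cong c (φ-inj φw≡)
  Coloured-functional (at-branch w refl refl) (on-path e x∈) = sym (colouredPath-branch e w x∈)
  Coloured-functional (on-path e x∈) (at-branch w refl refl) = colouredPath-branch e w x∈
  Coloured-functional {x} {β} {β′} (on-path {u} {v} e x∈) (on-path {u′} {v′} e′ x∈′) =
    decidable-stable (β ≟ᵇ β′) λ β≢β′ → ¬¬-excluded-middle {A = Σ V λ w → x ≡ φ w} λ where
      (yes (w , refl)) → β≢β′ (trans (colouredPath-branch e w x∈) (sym (colouredPath-branch e′ w x∈′)))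
      (no ¬φ) → β≢β′ (same-path (P-disj u v e u′ v′ e′ x (alternating-∈⁻ x∈) (alternating-∈⁻ x∈′) λ w x≡ → ¬φ (w , x≡)))
    where
    same-path : SamePair u v u′ v′ → β ≡ β′
    same-path (inj₁ (refl , refl)) =
      alternating-functional (P-unique e) x∈ (subst (λ l → (x , β′) ∈ alternating l (c u)) (P-irrelevant e′ e) x∈′)
    same-path (inj₂ (refl , refl)) = alternating-functional (P-unique e) x∈ (colouredPath-swap e′ e x∈′)

  edgeColours : V → V → List (Fin n × Bool)
  edgeColours u v with adj? u v
  ... | yes e = colouredPath e
  ... | no _ = []

  colourTable : List (Fin n × Bool)
  colourTable = map (λ w → φ w , c w) vertices ++ concatMap (λ (u , v) → edgeColours u v) (cartesianProduct vertices vertices)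

  colourTable-branch : ∀ w → (φ w , c w) ∈ colourTable
  colourTable-branch w = ∈-++⁺ˡ (∈-map⁺ (λ w → φ w , c w) (∈-vertices w))

  colourTable-path : ∀ {u v} (e : Adj H u v) {p} → p ∈ colouredPath e → p ∈ colourTable
  colourTable-path {u} {v} e {p} p∈ = ∈-++⁺ʳ _ (∈-concatMap⁺ (λ (u , v) → edgeColours u v)
    (Any.map (λ { refl → in-edgeColours }) (∈-cartesianProduct⁺ (∈-vertices u) (∈-vertices v))))
    where
    in-edgeColours : p ∈ edgeColours u v
    in-edgeColours with adj? u v
    ... | yes e′ = subst (λ l → p ∈ alternating l (c u)) (P-irrelevant e e′) p∈
    ... | no ¬e = ⊥-elim (¬e e)

  colourTable-∈⁻ : ∀ {x β} → (x , β) ∈ colourTable → Coloured x β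
  colourTable-∈⁻ x,β∈ with ∈-++⁻ (map (λ w → φ w , c w) vertices) x,β∈
  ... | inj₁ ∈branches with ∈-map⁻ (λ w → φ w , c w) ∈branches
  ...   | w , _ , refl = at-branch w refl refl
  colourTable-∈⁻ x,β∈ | inj₂ ∈paths with Any.satisfied (∈-concatMap⁻ (λ (u , v) → edgeColours u v)
                                                         {xs = cartesianProduct vertices vertices} ∈paths)
  ... | (u , v) , ∈edge = from-edgeColours ∈edge
    where
    from-edgeColours : ∀ {p} → p ∈ edgeColours u v → Coloured (proj₁ p) (proj₂ p)
    from-edgeColours p∈ with adj? u v
    ... | yes e = on-path e p∈

  firstColour : List (Fin n × Bool) → Fin n → Bool
  firstColour [] x = false
  firstColour ((y , β) ∷ l) x with x ≟ᶠ y
  ... | yes _ = β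
  ... | no _ = firstColour l x

  firstColour-∈ : ∀ l {x β} → (∀ {β′} → (x , β′) ∈ l → β′ ≡ β) → (x , β) ∈ l → firstColour l x ≡ β
  firstColour-∈ ((y , γ) ∷ l) {x} unique-colour x,β∈ with x ≟ᶠ y | x,β∈
  ... | yes refl | _ = unique-colour (here refl)
  ... | no x≢y | here refl = ⊥-elim (x≢y refl)
  ... | no _ | there x,β∈′ = firstColour-∈ l (unique-colour ∘′ there) x,β∈′

  colour : Fin n → Bool
  colour = firstColour colourTable

  colour-∈ : ∀ {x β} → (x , β) ∈ colourTable → colour x ≡ β
  colour-∈ x,β∈ = firstColour-∈ colourTable
    (λ x,β′∈ → Coloured-functional (colourTable-∈⁻ x,β′∈) (colourTable-∈⁻ x,β∈)) x,β∈

  support : List (Fin n)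
  support = filter (_∈? map proj₁ colourTable) (allFin n)

  m : ℕ
  m = length support

  ι : Fin m → Fin n
  ι = lookup support

  ι-inj : Injective _≡_ _≡_ ι
  ι-inj = lookup-injective (Unique.filter⁺ (_∈? map proj₁ colourTable) (Unique.allFin⁺ n))

  ∈-support : ∀ {x β} → (x , β) ∈ colourTable → x ∈ support
  ∈-support {x} x,β∈ = ∈-filter⁺ (_∈? map proj₁ colourTable) (∈-allFin x) (∈-map⁺ proj₁ x,β∈)

  ι-index : ∀ {x} (x∈ : x ∈ support) → ι (Any.index x∈) ≡ x
  ι-index x∈ = sym (lookup-index x∈)

  ∈P⇒∈support : ∀ {u v} (e : Adj H u v) {x} → x ∈ P u v e → x ∈ support
  ∈P⇒∈support {u} e x∈ = ∈-support (colourTable-path e (proj₂ (alternating-∈ (c u) x∈)))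

  φ̂ : V → Fin m
  φ̂ w = Any.index (∈-support (colourTable-branch w))

  ι-φ̂ : ∀ w → ι (φ̂ w) ≡ φ w
  ι-φ̂ w = ι-index (∈-support (colourTable-branch w))

  P̂ : (u v : V) → Adj H u v → List (Fin m)
  P̂ u v e = mapWith∈ (P u v e) (Any.index ∘′ ∈P⇒∈support e)

  map-ι-P̂ : ∀ u v e → map ι (P̂ u v e) ≡ P u v e
  map-ι-P̂ u v e = begin
    map ι (P̂ u v e)                                 ≡⟨ map-mapWith∈ (P u v e) _ ι ⟩
    mapWith∈ (P u v e) (ι ∘′ Any.index ∘′ ∈P⇒∈support e) ≡⟨ mapWith∈-cong (P u v e) _ _ (λ x∈ → ι-index (∈P⇒∈support e x∈)) ⟩
    mapWith∈ (P u v e) (λ {x} _ → x)                ≡⟨ mapWith∈-id (P u v e) ⟩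
    P u v e                                         ∎
    where open ≡-Reasoning

  P̂-unique : ∀ u v e → Unique (P̂ u v e)
  P̂-unique u v e = Unique.map⁻ (subst Unique (sym (map-ι-P̂ u v e)) (P-unique e))

  Consec-P̂ : ∀ {u v} (e : Adj H u v) {a b} → Consec a b (P̂ u v e) → Consec (ι a) (ι b) (P u v e)
  Consec-P̂ {u} {v} e c = subst (Consec _ _) (map-ι-P̂ u v e) (Consec-map⁺ ι c)

  ∈-P̂ : ∀ {u v} (e : Adj H u v) {a} → a ∈ P̂ u v e → ι a ∈ P u v e
  ∈-P̂ {u} {v} e a∈ = subst (_ ∈_) (map-ι-P̂ u v e) (∈-map⁺ ι a∈)

  ∈-P̂⁻ : ∀ {u v} (e : Adj H u v) {a} → ι a ∈ P u v e → a ∈ P̂ u v e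
  ∈-P̂⁻ {u} {v} e ιa∈ with ∈-map⁻ ι (subst (_ ∈_) (sym (map-ι-P̂ u v e)) ιa∈)
  ... | b , b∈ , ιa≡ιb = subst (_∈ P̂ u v e) (sym (ι-inj ιa≡ιb)) b∈

  Ĝ : Graph (Fin m)
  Ĝ = record
    { Adj = λ a b → ∃[ u ] ∃[ v ] Σ (Adj H u v) λ e → Consec a b (P̂ u v e) ⊎ Consec b a (P̂ u v e)
    ; adj-sym = λ (u , v , e , c) → u , v , e , swap⊎ c
    ; irrefl = λ where
        (u , v , e , inj₁ c) → Consec-≢ (P̂-unique u v e) c refl
        (u , v , e , inj₂ c) → Consec-≢ (P̂-unique u v e) c refl
    }

  Ĝ⊆G : SubgraphOf Ĝ G
  Ĝ⊆G = record
    { ι = ι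
    ; ι-inj = ι-inj
    ; ι-adj = λ where
        (u , v , e , inj₁ c) → Walk-Consec⇒Adj (P-walk e) (Consec-P̂ e c)
        (u , v , e , inj₂ c) → adj-sym G (Walk-Consec⇒Adj (P-walk e) (Consec-P̂ e c))
    }

  colour-Consec-P̂ : ∀ {u v} (e : Adj H u v) {a b} → Consec a b (P̂ u v e) → colour (ι a) ≢ colour (ι b)
  colour-Consec-P̂ e c with alternating-Consec (Consec-P̂ e c)
  ... | γ , a∈ , b∈ = subst₂ _≢_ (sym (colour-∈ (colourTable-path e a∈))) (sym (colour-∈ (colourTable-path e b∈)))
                        (not-¬ {γ} refl)

  Ĝ-bipartite : Bipartite Ĝ
  Ĝ-bipartite = colour ∘′ ι , λ where
    (u , v , e , inj₁ c) → colour-Consec-P̂ e c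
    (u , v , e , inj₂ c) → colour-Consec-P̂ e c ∘′ sym

  Ĝ-subdivision : SubdivisionOf Ĝ H
  Ĝ-subdivision = record
    { φ = φ̂
    ; φ-inj = λ {w} {w′} φ̂≡ → φ-inj (trans (sym (ι-φ̂ w)) (trans (cong ι φ̂≡) (ι-φ̂ w′)))
    ; P = P̂
    ; P-path = λ u v e → Walk-map⁻ ι-inj (P̂ u v e) (subst (Walk G (φ u) (φ v)) (sym (map-ι-P̂ u v e)) (P-walk e))
                           (λ c → u , v , e , inj₁ c) (ι-φ̂ u) (ι-φ̂ v)
                         , P̂-unique u v e
    ; P-rev = λ u v e e′ → map-injective ι-inj (begin
        map ι (P̂ v u e′)           ≡⟨ map-ι-P̂ v u e′ ⟩
        P v u e′                   ≡⟨ P-rev u v e e′ ⟩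
        reverse (P u v e)          ≡⟨ cong reverse (map-ι-P̂ u v e) ⟨
        reverse (map ι (P̂ u v e))  ≡⟨ reverse-map ι (P̂ u v e) ⟨
        map ι (reverse (P̂ u v e))  ∎)
    ; P-branch = λ u v e w φ̂w∈ → P-branch u v e w (subst (_∈ P u v e) (ι-φ̂ w) (∈-P̂ e φ̂w∈))
    ; P-disj = λ u v e u′ v′ e′ x x∈ x∈′ ¬branch → P-disj u v e u′ v′ e′ (ι x) (∈-P̂ e x∈) (∈-P̂ e′ x∈′)
                 λ w ιx≡ → ¬branch w (ι-inj (trans ιx≡ (sym (ι-φ̂ w))))
    ; cover-V = cover-V
    ; cover-E = λ _ _ adj → adj
    }
    where
    open ≡-Reasoning
    cover-V : ∀ a → (∃[ w ] a ≡ φ̂ w) ⊎ (∃[ u ] ∃[ v ] Σ (Adj H u v) λ e → a ∈ P̂ u v e)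
    cover-V a with ∈-map⁻ proj₁ (proj₂ (∈-filter⁻ (_∈? map proj₁ colourTable) {xs = allFin n} (∈-lookup {xs = support} a)))
    ... | (x , β) , x,β∈ , ιa≡x with colourTable-∈⁻ x,β∈
    ...   | at-branch w refl _ = inj₁ (w , ι-inj (trans ιa≡x (sym (ι-φ̂ w))))
    ...   | on-path {u} {v} e x∈ = inj₂ (u , v , e , ∈-P̂⁻ e (subst (_∈ P u v e) (sym ιa≡x) (alternating-∈⁻ x∈)))

  bipartite-subdivision : ∃[ m ] Σ (Graph (Fin m)) λ Ĝ → SubgraphOf Ĝ G × Bipartite Ĝ × SubdivisionOf Ĝ H
  bipartite-subdivision = m , Ĝ , Ĝ⊆G , Ĝ-bipartite , Ĝ-subdivision

-- Pigeonhole principle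

length-filter-Bool : {A : Set} (g : A → Bool) (xs : List A) →
  length (filter (λ x → g x ≟ᵇ true) xs) + length (filter (λ x → g x ≟ᵇ false) xs) ≡ length xs
length-filter-Bool g [] = refl
length-filter-Bool g (x ∷ xs) with g x
... | true = cong suc (length-filter-Bool g xs)
... | false = trans (+-suc _ _) (cong suc (length-filter-Bool g xs))

Vec-η : ∀ {A : Set} {d} (v : Vec A (suc d)) → v ≡ head v ∷ tail v
Vec-η (_ ∷ _) = refl

Vec-0 : ∀ {A : Set} (v : Vec A 0) → v ≡ []
Vec-0 [] = refl

+-≤-split : ∀ M a b → M + M ≤ a + b → M ≤ a ⊎ M ≤ b
+-≤-split M a b M+M≤ with M ≤? a | M ≤? b
... | yes M≤a | _ = inj₁ M≤a
... | no _ | yes M≤b = inj₂ M≤b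
... | no M≰a | no M≰b = ⊥-elim (<⇒≱ (+-mono-< (≰⇒> M≰a) (≰⇒> M≰b)) M+M≤)

-- Q is an arbitrary invariant of the indices, inherited by the selected ones.
pigeonhole : ∀ K d (f : ℕ → Vec Bool d) (Q : ℕ → Set) xs → Linked _<_ xs → All Q xs → K * 2 ^ d ≤ length xs →
  Σ (Vec Bool d) λ v → Σ (List ℕ) λ ys → Linked _<_ ys × K ≤ length ys × All (λ x → f x ≡ v) ys × All Q ys
pigeonhole K zero f Q xs sorted Qs K≤ =
  [] , xs , sorted , subst (_≤ length xs) (*-identityʳ K) K≤ , All.tabulate (λ {x} _ → Vec-0 (f x)) , Qs
pigeonhole K (suc d) f Q xs sorted Qs K≤ =
  [ within true , within false ]′ (+-≤-split (K * 2 ^ d) (length (class true)) (length (class false))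
    (subst₂ _≤_ halves (sym (length-filter-Bool (head ∘′ f) xs)) K≤))
  where
  class : Bool → List ℕ
  class β = filter (λ x → head (f x) ≟ᵇ β) xs
  halves : K * 2 ^ suc d ≡ K * 2 ^ d + K * 2 ^ d
  halves = trans (cong (λ z → K * (2 ^ d + z)) (+-identityʳ (2 ^ d))) (*-distribˡ-+ K (2 ^ d) (2 ^ d))
  within : ∀ β → K * 2 ^ d ≤ length (class β) →
    Σ (Vec Bool (suc d)) λ v → Σ (List ℕ) λ ys → Linked _<_ ys × K ≤ length ys × All (λ x → f x ≡ v) ys × All Q ys
  within β K≤β with pigeonhole K d (tail ∘′ f) (λ x → Q x × head (f x) ≡ β) (class β)
                      (Linked.filter⁺ _ <-trans sorted) (All.zip (All.filter⁺ _ Qs , All.all-filter _ xs)) K≤β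
  ... | v , ys , sorted′ , K≤′ , tails , Qs′ = β ∷ v , ys , sorted′ , K≤′ ,
        All.zipWith (λ {x} (tail≡ , (_ , head≡)) → trans (Vec-η (f x)) (cong₂ _∷_ head≡ tail≡)) (tails , Qs′) ,
        All.map proj₁ Qs′

-- 0 past the end of the list.
nth : List ℕ → ℕ → ℕ
nth [] t = 0
nth (x ∷ xs) zero = x
nth (x ∷ xs) (suc t) = nth xs t

nth-All : {P : ℕ → Set} {xs : List ℕ} → All P xs → ∀ t → t < length xs → P (nth xs t)
nth-All (p ∷ _) zero _ = p
nth-All (_ ∷ ps) (suc t) (s≤s t<) = nth-All ps t t<

nth-Linked : {xs : List ℕ} → Linked _<_ xs → ∀ t → suc t < length xs → nth xs t < nth xs (suc t)
nth-Linked [-] t (s≤s ())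
nth-Linked (x<y ∷ _) zero _ = x<y
nth-Linked (_ ∷ sorted) (suc t) (s≤s t<) = nth-Linked sorted t t<

-- Walls

⌊/2⌋-< : ∀ {a k} → a < 2 * k → ⌊ a /2⌋ < k
⌊/2⌋-< {a} {k} a<2k = ≰⇒> λ k≤ → <⇒≱ a<2k (begin
  2 * k                       ≡⟨ cong (k +_) (+-identityʳ k) ⟩
  k + k                       ≤⟨ +-mono-≤ k≤ k≤ ⟩
  ⌊ a /2⌋ + ⌊ a /2⌋           ≤⟨ +-monoʳ-≤ ⌊ a /2⌋ (⌊n/2⌋≤⌈n/2⌉ a) ⟩
  ⌊ a /2⌋ + ⌈ a /2⌉           ≡⟨ ⌊n/2⌋+⌈n/2⌉≡n a ⟩
  a                           ∎)
  where open ≤-Reasoning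

⌊suc/2⌋ : ∀ a → (a % 2 ≡ 0 × ⌊ suc a /2⌋ ≡ ⌊ a /2⌋ × suc a % 2 ≡ 1) ⊎
                (a % 2 ≡ 1 × ⌊ suc a /2⌋ ≡ suc ⌊ a /2⌋ × suc a % 2 ≡ 0)
⌊suc/2⌋ zero = inj₁ (refl , refl , refl)
⌊suc/2⌋ (suc zero) = inj₂ (refl , refl , refl)
⌊suc/2⌋ (suc (suc a)) with ⌊suc/2⌋ a
... | inj₁ (p , q , r) = inj₁ (p , cong suc q , r)
... | inj₂ (p , q , r) = inj₂ (p , cong suc q , r)

module Columns (k j : ℕ) (b : ℕ → ℕ) (b-mono : ∀ t → suc t < k → b t < b (suc t))
  (b-bound : ∀ t → t < k → b t < j) where

  -- Columns 2t and 2t + 1 of the small wall go to columns 2 b t and 2 b t + 1.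
  col : ℕ → ℕ
  col a = 2 * b ⌊ a /2⌋ + a % 2

  col-%2 : ∀ a → col a % 2 ≡ a % 2
  col-%2 a = begin
    (2 * b ⌊ a /2⌋ + a % 2) % 2   ≡⟨ cong (_% 2) (trans (+-comm (2 * b ⌊ a /2⌋) (a % 2)) (cong (a % 2 +_) (*-comm 2 (b ⌊ a /2⌋)))) ⟩
    (a % 2 + b ⌊ a /2⌋ * 2) % 2   ≡⟨ [m+kn]%n≡m%n (a % 2) (b ⌊ a /2⌋) 2 ⟩
    a % 2 % 2                     ≡⟨ m%n%n≡m%n a 2 ⟩
    a % 2                         ∎
    where open ≡-Reasoning

  2*-suc-≤ : ∀ {x y} → x < y → 2 * x + 2 ≤ 2 * y
  2*-suc-≤ {x} {y} x<y = subst (_≤ 2 * y) (trans (*-suc 2 x) (+-comm 2 (2 * x))) (*-monoʳ-≤ 2 x<y)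

  col-<-suc : ∀ a → suc a < 2 * k → col a < col (suc a)
  col-<-suc a a+1<2k with ⌊suc/2⌋ a
  ... | inj₁ (p , q , r) rewrite p | q | r = subst (_< 2 * b ⌊ a /2⌋ + 1) (sym (+-identityʳ _)) (m<m+n _ (s≤s z≤n))
  ... | inj₂ (p , q , r) rewrite p | q | r = begin-strict
    2 * b ⌊ a /2⌋ + 1          <⟨ +-monoʳ-< (2 * b ⌊ a /2⌋) (s≤s (s≤s z≤n)) ⟩
    2 * b ⌊ a /2⌋ + 2          ≤⟨ 2*-suc-≤ (b-mono ⌊ a /2⌋ (subst (_< k) q (⌊/2⌋-< a+1<2k))) ⟩
    2 * b (suc ⌊ a /2⌋)        ≡⟨ +-identityʳ _ ⟨
    2 * b (suc ⌊ a /2⌋) + 0    ∎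
    where open ≤-Reasoning

  col-strictMono : ∀ {a a′} → a < a′ → a′ < 2 * k → col a < col a′
  col-strictMono {a} {suc a′} (s≤s a≤a′) a′+1<2k with m≤n⇒m<n∨m≡n a≤a′
  ... | inj₁ a<a′ = <-trans (col-strictMono a<a′ (<-trans (n<1+n a′) a′+1<2k)) (col-<-suc a′ a′+1<2k)
  ... | inj₂ refl = col-<-suc a a′+1<2k

  col-mono : ∀ {a a′} → a ≤ a′ → a′ < 2 * k → col a ≤ col a′
  col-mono a≤a′ a′<2k with m≤n⇒m<n∨m≡n a≤a′
  ... | inj₁ a<a′ = <⇒≤ (col-strictMono a<a′ a′<2k)
  ... | inj₂ refl = ≤-refl

  col-reflects-≤ : ∀ {a a′} → a < 2 * k → col a ≤ col a′ → a ≤ a′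
  col-reflects-≤ {a} {a′} a<2k col≤ with a ≤? a′
  ... | yes a≤a′ = a≤a′
  ... | no a≰a′ = ⊥-elim (<⇒≱ (col-strictMono (≰⇒> a≰a′) a<2k) col≤)

  col-injective : ∀ {a a′} → a < 2 * k → a′ < 2 * k → col a ≡ col a′ → a ≡ a′
  col-injective a<2k a′<2k col≡ =
    ≤-antisym (col-reflects-≤ a<2k (≤-reflexive col≡)) (col-reflects-≤ a′<2k (≤-reflexive (sym col≡)))

  col-< : ∀ {a} → a < 2 * k → col a < 2 * j
  col-< {a} a<2k = begin-strict
    2 * b ⌊ a /2⌋ + a % 2      <⟨ +-monoʳ-< (2 * b ⌊ a /2⌋) (m%n<n a 2) ⟩
    2 * b ⌊ a /2⌋ + 2          ≤⟨ 2*-suc-≤ (b-bound ⌊ a /2⌋ (⌊/2⌋-< a<2k)) ⟩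
    2 * j                      ∎
    where open ≤-Reasoning

clamp : ∀ N → 0 < N → ℕ → Fin N
clamp N 0<N x with x <? N
... | yes x<N = fromℕ< x<N
... | no _ = fromℕ< 0<N

toℕ-clamp : ∀ {N} (0<N : 0 < N) {x} → x < N → toℕ (clamp N 0<N x) ≡ x
toℕ-clamp {N} 0<N {x} x<N with x <? N
... | yes x<N′ = toℕ-fromℕ< x<N′
... | no x≮N = ⊥-elim (x≮N x<N)

clamp-toℕ : ∀ {N} (0<N : 0 < N) (i : Fin N) → clamp N 0<N (toℕ i) ≡ i
clamp-toℕ 0<N i = toℕ-injective (toℕ-clamp 0<N (toℕ<n i))

module _ {j k : ℕ} where

  _≟ʷ_ : DecidableEquality (WallV j k)
  _≟ʷ_ = ≡-dec _≟ᶠ_ _≟ᶠ_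

  WallR? : (u v : WallV j k) → Dec (WallR j k u v)
  WallR? (i , a) (i′ , a′) with i ≟ᶠ i′
  ... | yes refl with toℕ a′ ≟ℕ suc (toℕ a)
  ...   | yes a′≡ = yes (horiz a′≡)
  ...   | no a′≢ = no λ { (horiz a′≡) → a′≢ a′≡ ; (vert i≡ _) → n≢1+n _ i≡ }
  WallR? (i , a) (i′ , a′) | no i≢i′ with toℕ i′ ≟ℕ suc (toℕ i) | a ≟ᶠ a′ | toℕ a % 2 ≟ℕ toℕ i′ % 2
  ... | yes i′≡ | yes refl | yes a≡ = yes (vert i′≡ a≡)
  ... | no i′≢ | _ | _ = no λ { (horiz _) → i≢i′ refl ; (vert i′≡ _) → i′≢ i′≡ }
  ... | yes _ | no a≢a′ | _ = no λ { (horiz _) → i≢i′ refl ; (vert _ _) → a≢a′ refl }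
  ... | yes _ | yes refl | no a≢ = no λ { (horiz _) → i≢i′ refl ; (vert _ a≡) → a≢ a≡ }

  Wall-adj? : (u v : WallV j k) → Dec (Adj (Wall j k) u v)
  Wall-adj? u v = WallR? u v ⊎-dec WallR? v u

  WallR-irrelevant : ∀ {u v} (r r′ : WallR j k u v) → r ≡ r′
  WallR-irrelevant (horiz p) (horiz q) = cong horiz (≡-irrelevant p q)
  WallR-irrelevant (horiz _) (vert q _) = ⊥-elim (n≢1+n _ q)
  WallR-irrelevant (vert p _) (horiz _) = ⊥-elim (n≢1+n _ p)
  WallR-irrelevant (vert p q) (vert p′ q′) = cong₂ vert (≡-irrelevant p p′) (≡-irrelevant q q′)

  WallR-asym : ∀ {u v} → WallR j k u v → WallR j k v u → ⊥
  WallR-asym (horiz p) (horiz q) = <-asym (≤-reflexive (sym p)) (≤-reflexive (sym q))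
  WallR-asym (horiz _) (vert q _) = n≢1+n _ q
  WallR-asym (vert p _) (horiz _) = n≢1+n _ p
  WallR-asym (vert p _) (vert q _) = <-asym (≤-reflexive (sym p)) (≤-reflexive (sym q))

  wallVertices : List (WallV j k)
  wallVertices = cartesianProduct (allFin k) (allFin (2 * j))

  ∈-wallVertices : ∀ v → v ∈ wallVertices
  ∈-wallVertices (i , a) = ∈-cartesianProduct⁺ (∈-allFin i) (∈-allFin a)

module WallParities {j k : ℕ} (0<k : 0 < k) (0<j : 0 < j) {n : ℕ} {G : Graph (Fin n)}
  (S : TopMinor G (Wall j k)) where

  open TopMinor S

  -- Out-of-range columns and the row below the last one are clamped to junk values.
  vertex : Fin k → ℕ → WallV j k
  vertex i x = i , clamp (2 * j) (*-monoʳ-< 2 0<j) x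

  rowBelow : Fin k → Fin k
  rowBelow i = clamp k 0<k (suc (toℕ i))

  vertex-injective : ∀ {i i′ x x′} → x < 2 * j → x′ < 2 * j → vertex i x ≡ vertex i′ x′ → i ≡ i′ × x ≡ x′
  vertex-injective x< x′< v≡ = cong proj₁ v≡ ,
    trans (sym (toℕ-clamp _ x<)) (trans (cong (toℕ ∘′ proj₂) v≡) (toℕ-clamp _ x′<))

  pathParity? : ∀ {a b} → Dec (Adj (Wall j k) a b) → Bool
  pathParity? (yes e) = pathParity e
  pathParity? (no _) = false

  edgeParity : WallV j k → WallV j k → Bool
  edgeParity a b = pathParity? (Wall-adj? a b)

  pathParity≡edgeParity : ∀ {a b} (e : Adj (Wall j k) a b) → pathParity e ≡ edgeParity a b
  pathParity≡edgeParity {a} {b} e = from-dec (Wall-adj? a b)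
    where
    from-dec : (d : Dec (Adj (Wall j k) a b)) → pathParity e ≡ pathParity? d
    from-dec (yes e′) = cong (not ∘′ oddLength) (P-irrelevant e e′)
    from-dec (no ¬e) = ⊥-elim (¬e e)

  listParityFrom : WallV j k → List (WallV j k) → Bool
  listParityFrom a [] = false
  listParityFrom a (b ∷ l) = edgeParity a b xor listParityFrom b l

  listParity : List (WallV j k) → Bool
  listParity [] = false
  listParity (a ∷ l) = listParityFrom a l

  listParityFrom-Walk : ∀ a {y z ys} → Walk (Wall j k) y z ys → listParityFrom a ys ≡ edgeParity a y xor listParity ys
  listParityFrom-Walk a [ y ] = refl
  listParityFrom-Walk a (_ ∷ _) = refl

  walkParity≡listParity : ∀ {x y xs} (w : Walk (Wall j k) x y xs) → walkParity w ≡ listParity xs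
  walkParity≡listParity [ x ] = refl
  walkParity≡listParity {x} (e ∷ w) =
    trans (cong₂ _xor_ (pathParity≡edgeParity e) (walkParity≡listParity w)) (sym (listParityFrom-Walk x w))

  rowParity : Fin k → ℕ → Bool
  rowParity i zero = false
  rowParity i (suc x) = rowParity i x xor edgeParity (vertex i x) (vertex i (suc x))

  rowSegment : Fin k → ℕ → ℕ → List (WallV j k)
  rowSegment i x zero = vertex i x ∷ []
  rowSegment i x (suc d) = vertex i x ∷ rowSegment i (suc x) d

  listParity-rowSegment : ∀ i x d → listParity (rowSegment i x d) ≡ rowParity i x xor rowParity i (x + d)
  listParity-rowSegment i x zero = trans (sym (xor-same (rowParity i x))) (cong (λ y → rowParity i x xor rowParity i y) (sym (+-identityʳ x)))
  listParity-rowSegment i x (suc d) = begin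
    listParityFrom (vertex i x) (rowSegment i (suc x) d)            ≡⟨ first-edge d ⟩
    e xor listParity (rowSegment i (suc x) d)                       ≡⟨ cong (e xor_) (listParity-rowSegment i (suc x) d) ⟩
    e xor ((rowParity i x xor e) xor rowParity i (suc x + d))       ≡⟨ telescope e (rowParity i x) (rowParity i (suc x + d)) ⟩
    rowParity i x xor rowParity i (suc x + d)                       ≡⟨ cong (λ y → rowParity i x xor rowParity i y) (sym (+-suc x d)) ⟩
    rowParity i x xor rowParity i (x + suc d)                       ∎
    where
    open ≡-Reasoning
    e = edgeParity (vertex i x) (vertex i (suc x))
    first-edge : ∀ d → listParityFrom (vertex i x) (rowSegment i (suc x) d) ≡ e xor listParity (rowSegment i (suc x) d)
    first-edge zero = refl
    first-edge (suc d) = refl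
    telescope : ∀ e r s → e xor ((r xor e) xor s) ≡ r xor s
    telescope = solve 3 (λ e r s → e :+ ((r :+ e) :+ s) := r :+ s) refl
      where open xor-∧-Solver

  rowSegment-walk : ∀ i x d → x + d < 2 * j → Walk (Wall j k) (vertex i x) (vertex i (x + d)) (rowSegment i x d)
  rowSegment-walk i x zero _ rewrite +-identityʳ x = [ vertex i x ]
  rowSegment-walk i x (suc d) x+d+1< = inj₁ (horiz step) ∷ subst (λ y → Walk (Wall j k) (vertex i (suc x)) (vertex i y) (rowSegment i (suc x) d))
                                       (sym (+-suc x d)) (rowSegment-walk i (suc x) d x+1+d<)
    where
    x+1+d< : suc x + d < 2 * j
    x+1+d< = subst (_< 2 * j) (+-suc x d) x+d+1<
    step : toℕ (proj₂ (vertex i (suc x))) ≡ suc (toℕ (proj₂ (vertex i x)))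
    step = trans (toℕ-clamp _ (≤-<-trans (m≤m+n (suc x) d) x+1+d<))
                 (cong suc (sym (toℕ-clamp _ (≤-<-trans (m≤m+n x (suc d)) x+d+1<))))

  rowSegment-∈ : ∀ {i x d z} → z ∈ rowSegment i x d → Σ ℕ λ t → x ≤ t × t ≤ x + d × z ≡ vertex i t
  rowSegment-∈ {x = x} {zero} (here refl) = x , ≤-refl , m≤m+n x 0 , refl
  rowSegment-∈ {x = x} {suc d} (here refl) = x , ≤-refl , m≤m+n x (suc d) , refl
  rowSegment-∈ {x = x} {suc d} (there z∈) with rowSegment-∈ z∈
  ... | t , x+1≤t , t≤ , z≡ = t , ≤-trans (n≤1+n x) x+1≤t , subst (t ≤_) (sym (+-suc x d)) t≤ , z≡

  rowSegment-unique : ∀ i x d → x + d < 2 * j → Unique (rowSegment i x d)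
  rowSegment-unique i x zero _ = [] ∷ []
  rowSegment-unique i x (suc d) x+d+1< = All.tabulate vertex-x∉ ∷ rowSegment-unique i (suc x) d x+1+d<
    where
    x+1+d< : suc x + d < 2 * j
    x+1+d< = subst (_< 2 * j) (+-suc x d) x+d+1<
    vertex-x∉ : ∀ {z} → z ∈ rowSegment i (suc x) d → vertex i x ≢ z
    vertex-x∉ z∈ v≡z with rowSegment-∈ z∈
    ... | t , x<t , t≤ , refl =
      <⇒≢ x<t (proj₂ (vertex-injective (≤-<-trans (m≤m+n x (suc d)) x+d+1<) (≤-<-trans t≤ x+1+d<) v≡z))

  -- The β-th rung between rows i and i + 1: these rungs sit in the columns of parity i + 1.
  verticalColumn : Fin k → ℕ → ℕ
  verticalColumn i β = 2 * β + suc (toℕ i) % 2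

  -- Parity of the walk along row i to this rung, across it, and back along row i + 1.
  potential : Fin k → ℕ → Bool
  potential i β = (rowParity i x xor rowParity (rowBelow i) x) xor edgeParity (vertex i x) (vertex (rowBelow i) x)
    where x = verticalColumn i β

  potentials : ℕ → Vec Bool k
  potentials β = tabulate λ i → potential i β

  module SelectedColumns (v : Vec Bool k) (b : ℕ → ℕ) (b-mono : ∀ t → suc t < k → b t < b (suc t))
    (b-bound : ∀ t → t < k → b t < j) (b-potentials : ∀ t → t < k → potentials (b t) ≡ v) where

    open Columns k j b b-mono b-bound

    colᶠ : Fin (2 * k) → ℕ
    colᶠ a = col (toℕ a)

    colᶠ-< : ∀ a → colᶠ a < 2 * j
    colᶠ-< a = col-< (toℕ<n a)

    ψ : WallV k k → WallV j k
    ψ (i , a) = vertex i (colᶠ a)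

    ψ-inj : Injective _≡_ _≡_ ψ
    ψ-inj {i , a} {i′ , a′} ψ≡ with vertex-injective (colᶠ-< a) (colᶠ-< a′) ψ≡
    ... | refl , col≡ = cong (i ,_) (toℕ-injective (col-injective (toℕ<n a) (toℕ<n a′) col≡))

    module Horizontal {a a′ : Fin (2 * k)} (a′≡ : toℕ a′ ≡ suc (toℕ a)) (i : Fin k) where

      span : ℕ
      span = colᶠ a′ ∸ colᶠ a

      end≡ : colᶠ a + span ≡ colᶠ a′
      end≡ = m+[n∸m]≡n (<⇒≤ (col-strictMono (≤-reflexive (sym a′≡)) (toℕ<n a′)))

      end< : colᶠ a + span < 2 * j
      end< = subst (_< 2 * j) (sym end≡) (colᶠ-< a′)

      segment : List (WallV j k)
      segment = rowSegment i (colᶠ a) span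

      segment-walk : Walk (Wall j k) (ψ (i , a)) (ψ (i , a′)) segment
      segment-walk = subst (λ y → Walk (Wall j k) (ψ (i , a)) (vertex i y) segment) end≡
        (rowSegment-walk i (colᶠ a) span end<)

      segment-unique : Unique segment
      segment-unique = rowSegment-unique i (colᶠ a) span end<

      segment-branch : ∀ x → ψ x ∈ segment → (x ≡ (i , a)) ⊎ (x ≡ (i , a′))
      segment-branch (i″ , a″) ψx∈ with rowSegment-∈ ψx∈
      ... | t , a≤t , t≤ , ψ≡ with vertex-injective (colᶠ-< a″) (≤-<-trans t≤ end<) ψ≡
      ... | refl , refl with m≤n⇒m<n∨m≡n (subst (toℕ a″ ≤_) a′≡ (col-reflects-≤ (toℕ<n a″) (subst (colᶠ a″ ≤_) end≡ t≤)))
      ...   | inj₂ a″≡ = inj₂ (cong (i ,_) (toℕ-injective (trans a″≡ (sym a′≡))))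
      ...   | inj₁ (s≤s a″≤) = inj₁ (cong (i ,_) (toℕ-injective (≤-antisym a″≤ (col-reflects-≤ (toℕ<n a) a≤t))))

      Interior : WallV j k → Set
      Interior z = Σ ℕ λ t → colᶠ a < t × t < colᶠ a′ × t < 2 * j × z ≡ vertex i t

      segment-interior : ∀ {z} → z ∈ segment → (∀ x → z ≢ ψ x) → Interior z
      segment-interior z∈ ¬branch with rowSegment-∈ z∈
      ... | t , a≤t , t≤ , refl = t , ≤∧≢⇒< a≤t (λ { refl → ¬branch (i , a) refl }) ,
        ≤∧≢⇒< (subst (t ≤_) end≡ t≤) (λ { refl → ¬branch (i , a′) refl }) , ≤-<-trans t≤ end< , refl

    Q : ∀ {u w} → WallR k k u w → List (WallV j k)
    Q (horiz {i} a′≡) = Horizontal.segment a′≡ i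
    Q (vert {i} {i′} {a} _ _) = ψ (i , a) ∷ ψ (i′ , a) ∷ []

    Q-walk : ∀ {u w} (r : WallR k k u w) → Walk (Wall j k) (ψ u) (ψ w) (Q r)
    Q-walk (horiz {i} a′≡) = Horizontal.segment-walk a′≡ i
    Q-walk (vert {i} {i′} {a} i′≡ a≡) = inj₁ (vert i′≡ a-parity) ∷ [ ψ (i′ , a) ]
      where
      a-parity : toℕ (proj₂ (ψ (i , a))) % 2 ≡ toℕ i′ % 2
      a-parity = trans (cong (_% 2) (toℕ-clamp _ (colᶠ-< a))) (trans (col-%2 (toℕ a)) a≡)

    Q-unique : ∀ {u w} (r : WallR k k u w) → Unique (Q r)
    Q-unique (horiz {i} a′≡) = Horizontal.segment-unique a′≡ i
    Q-unique (vert {i} i′≡ _) = ((λ ψ≡ → n≢1+n (toℕ i) (trans (cong (toℕ ∘′ proj₁) ψ≡) i′≡)) ∷ []) ∷ [] ∷ []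

    Q-branch : ∀ {u w} (r : WallR k k u w) x → ψ x ∈ Q r → (x ≡ u) ⊎ (x ≡ w)
    Q-branch (horiz {i} a′≡) = Horizontal.segment-branch a′≡ i
    Q-branch (vert _ _) x (here ψ≡) = inj₁ (ψ-inj ψ≡)
    Q-branch (vert _ _) x (there (here ψ≡)) = inj₂ (ψ-inj ψ≡)

    overlapping-segments : ∀ {a a′ a₁ a₁′ : Fin (2 * k)} → toℕ a′ ≡ suc (toℕ a) → toℕ a₁′ ≡ suc (toℕ a₁) →
      ∀ {t} → colᶠ a < t → t < colᶠ a′ → colᶠ a₁ < t → t < colᶠ a₁′ → a ≡ a₁
    overlapping-segments {a} {a′} {a₁} {a₁′} a′≡ a₁′≡ a<t t<a′ a₁<t t<a₁′ with <-cmp (toℕ a) (toℕ a₁)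
    ... | tri< a<a₁ _ _ = ⊥-elim (<⇒≱ (<-trans a₁<t t<a′)
                            (col-mono (subst (_≤ toℕ a₁) (sym a′≡) a<a₁) (toℕ<n a₁)))
    ... | tri≈ _ a≡a₁ _ = toℕ-injective a≡a₁
    ... | tri> _ _ a₁<a = ⊥-elim (<⇒≱ (<-trans a<t t<a₁′)
                            (col-mono (subst (_≤ toℕ a) (sym a₁′≡) a₁<a) (toℕ<n a)))

    Q-disj : ∀ {u w u′ w′} (r : WallR k k u w) (r′ : WallR k k u′ w′) z → z ∈ Q r → z ∈ Q r′ →
             (∀ x → z ≢ ψ x) → SamePair u w u′ w′
    Q-disj (vert {i} {a = a} _ _) _ z (here z≡) _ ¬branch = ⊥-elim (¬branch (i , a) z≡)
    Q-disj (vert {i' = i′} {a = a} _ _) _ z (there (here z≡)) _ ¬branch = ⊥-elim (¬branch (i′ , a) z≡)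
    Q-disj (horiz _) (vert {i} {a = a} _ _) z _ (here z≡) ¬branch = ⊥-elim (¬branch (i , a) z≡)
    Q-disj (horiz _) (vert {i' = i′} {a = a} _ _) z _ (there (here z≡)) ¬branch = ⊥-elim (¬branch (i′ , a) z≡)
    Q-disj (horiz {i} {a} {a′} a′≡) (horiz {i₁} {a₁} {a₁′} a₁′≡) z z∈ z∈′ ¬branch
      with Horizontal.segment-interior a′≡ i z∈ ¬branch | Horizontal.segment-interior a₁′≡ i₁ z∈′ ¬branch
    ... | t , a<t , t<a′ , t< , refl | t₁ , a₁<t₁ , t₁<a₁′ , t₁< , z≡ with vertex-injective t< t₁< z≡
    ... | refl , refl with overlapping-segments a′≡ a₁′≡ a<t t<a′ a₁<t₁ t₁<a₁′
    ... | refl = inj₁ (refl , cong (i ,_) (toℕ-injective (trans a′≡ (sym a₁′≡))))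

    selectedWall : OrientedTopMinor (Wall j k) (WallR k k)
    selectedWall = record
      { ψ = ψ ; ψ-inj = ψ-inj ; Q = Q ; Q-walk = Q-walk ; Q-unique = Q-unique ; Q-branch = Q-branch ; Q-disj = Q-disj }

    rowShift : ℕ → Bool
    rowShift zero = false
    rowShift (suc r) = rowShift r xor lookupᵛ v (clamp k 0<k r)

    -- Along a row the colouring follows the parities of the row path; consecutive rows
    -- are shifted by the common potential, which makes every selected rung consistent.
    colouring : WallV k k → Bool
    colouring (i , a) = rowShift (toℕ i) xor rowParity i (colᶠ a)

    listParity-Q : ∀ {u w} (r : WallR k k u w) → listParity (Q r) ≡ colouring u xor colouring w
    listParity-Q (horiz {i} {a} {a′} a′≡) = begin
      listParity (rowSegment i (colᶠ a) span)              ≡⟨ listParity-rowSegment i (colᶠ a) span ⟩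
      rowParity i (colᶠ a) xor rowParity i (colᶠ a + span) ≡⟨ cong (λ y → rowParity i (colᶠ a) xor rowParity i y) end≡ ⟩
      rowParity i (colᶠ a) xor rowParity i (colᶠ a′)       ≡⟨ shift-cancels (rowShift (toℕ i)) _ _ ⟩
      colouring (i , a) xor colouring (i , a′)             ∎
      where
      open ≡-Reasoning
      open Horizontal a′≡ i
      shift-cancels : ∀ s r r′ → r xor r′ ≡ (s xor r) xor (s xor r′)
      shift-cancels = xor-∧-Solver.solve 3 (λ s r r′ → r :+ r′ := (s :+ r) :+ (s :+ r′)) refl
        where open xor-∧-Solver
    listParity-Q (vert {i} {i′} {a} i′≡ a≡) = begin
      ω xor false                                                   ≡⟨ rung-cancels s r r′ ω ⟨
      (s xor r) xor ((s xor ((r xor r′) xor ω)) xor r′)             ≡⟨ cong (λ p → (s xor r) xor ((s xor p) xor r′)) potential≡ ⟨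
      (s xor r) xor ((s xor lookupᵛ v i) xor r′)                    ≡⟨ cong (λ p → (s xor r) xor (p xor r′)) shift≡ ⟨
      colouring (i , a) xor colouring (i′ , a)                      ∎
      where
      open ≡-Reasoning
      s = rowShift (toℕ i)
      r = rowParity i (colᶠ a)
      r′ = rowParity i′ (colᶠ a)
      ω = edgeParity (ψ (i , a)) (ψ (i′ , a))
      t = ⌊ toℕ a /2⌋
      rung-cancels : ∀ s r r′ ω → (s xor r) xor ((s xor ((r xor r′) xor ω)) xor r′) ≡ ω xor false
      rung-cancels = xor-∧-Solver.solve 4 (λ s r r′ ω → (s :+ r) :+ ((s :+ ((r :+ r′) :+ ω)) :+ r′) := ω :+ con false) refl
        where open xor-∧-Solver
      shift≡ : rowShift (toℕ i′) ≡ s xor lookupᵛ v i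
      shift≡ = trans (cong rowShift i′≡) (cong (λ i″ → s xor lookupᵛ v i″) (clamp-toℕ 0<k i))
      below≡ : rowBelow i ≡ i′
      below≡ = toℕ-injective (trans (toℕ-clamp 0<k (subst (_< k) i′≡ (toℕ<n i′))) (sym i′≡))
      column≡ : verticalColumn i (b t) ≡ colᶠ a
      column≡ = cong (2 * b t +_) (sym (trans a≡ (cong (_% 2) i′≡)))
      potential≡ : lookupᵛ v i ≡ (r xor r′) xor ω
      potential≡ = begin
        lookupᵛ v i                      ≡⟨ cong (λ u → lookupᵛ u i) (b-potentials t (⌊/2⌋-< (toℕ<n a))) ⟨
        lookupᵛ (potentials (b t)) i     ≡⟨ lookup∘tabulate (λ i → potential i (b t)) i ⟩
        potential i (b t)                ≡⟨ cong₂ (λ x i″ → (rowParity i x xor rowParity i″ x) xor edgeParity (vertex i x) (vertex i″ x))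
                                                  column≡ below≡ ⟩
        (r xor r′) xor ω                 ∎

    walkParity-Q : ∀ {u w} (r : WallR k k u w) → walkParity (Q-walk r) ≡ colouring u xor colouring w
    walkParity-Q r = trans (walkParity≡listParity (Q-walk r)) (listParity-Q r)

    bipartite-wall : ∃[ m ] Σ (Graph (Fin m)) λ Ĝ → SubgraphOf Ĝ G × Bipartite Ĝ × SubdivisionOf Ĝ (Wall k k)
    bipartite-wall = BipartiteSubdivision.bipartite-subdivision smallWall (wallVertices {k} {k}) (∈-wallVertices {k} {k}) Wall-adj?
                       colouring (composite-parity (Wall k k) _≟ˢ_ id WallR-asym WallR-irrelevant colouring walkParity-Q)
      where
      _≟ˢ_ : DecidableEquality (WallV k k)
      _≟ˢ_ = _≟ʷ_ {k} {k}
      open Compose S selectedWall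
      smallWall : TopMinor G (Wall k k)
      smallWall = composite (Wall k k) _≟ˢ_ id WallR-asym WallR-irrelevant

  bipartite-small-wall : k * 2 ^ k ≤ j →
    ∃[ m ] Σ (Graph (Fin m)) λ Ĝ → SubgraphOf Ĝ G × Bipartite Ĝ × SubdivisionOf Ĝ (Wall k k)
  bipartite-small-wall k2^k≤j with pigeonhole k k potentials (_< j) (upTo j) (Linked.applyUpTo⁺₂ id j n<1+n)
                                     (All.tabulate ∈-upTo⁻) (subst (k * 2 ^ k ≤_) (sym (length-upTo j)) k2^k≤j)
  ... | v , ys , sorted , k≤ , same , bounded = SelectedColumns.bipartite-wall v (nth ys)
    (λ t t+1<k → nth-Linked sorted t (<-≤-trans t+1<k k≤)) (λ t t<k → nth-All bounded t (<-≤-trans t<k k≤))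
    (λ t t<k → nth-All same t (<-≤-trans t<k k≤))

mainTheorem10 : (k : ℕ) → 1 ≤ k → {n : ℕ} → (G : Graph (Fin n)) →
    SubdivisionOf G (Wall (k * 2 ^ k) k) →
    ∃[ m ] Σ (Graph (Fin m)) λ Ĝ →
      SubgraphOf Ĝ G × Bipartite Ĝ × SubdivisionOf Ĝ (Wall k k)
mainTheorem10 k 0<k G S =
  WallParities.bipartite-small-wall 0<k (*-mono-≤ 0<k (m^n>0 2 k)) (SubdivisionOf⇒TopMinor S) ≤-refl
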